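{- Fix a directed graph $G$ on vertex set $V$ with $|V|=n$ and integer edge weights in $\{1,\dots,M\}$. For some large constant $C$, with high probability over a uniformly random bijection $\pi:V\to[n]$, the following holds: for every pair of vertices $u,v\in V$ with $2\le|uv|<\infty$, there is a shortest path $\rho'(u,v)$ from $u$ to $v$ and an internal vertex $z$ of $\rho'(u,v)$ such that $\pi(z)\le CMn\ln n/\|uv\|$.
   Context: $\|uv\|$ is the shortest-path distance from $u$ to $v$; $|uv|$ is the largest number of edges of any shortest path from $u$ to $v$ ($\infty$ if no path exists). An internal vertex of a path from $u$ to $v$ is a vertex on it other than $u$ and $v$. "With high probability" means with probability at least $1-1/n^c$ for a constant $c$ that can be made arbitrarily large (by choosing $C$ large). -}

module Defs where

open import Data.Nat using (ℕ; zero; suc; _+_; _*_; _≤_; _^_; _!)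
open import Data.Nat.Logarithm using (⌊log₂_⌋)

open import Data.Fin using (Fin; toℕ)
open import Data.Maybe using (Maybe; just)
open import Data.List using (List; []; _∷_; length)
open import Data.List.Membership.Propositional using (_∈_)
open import Data.List.Relation.Unary.All using (All)
open import Data.List.Relation.Unary.AllPairs using (AllPairs)
open import Data.Product using (Σ; ∃; _×_)
open import Relation.Binary.PropositionalEquality using (_≡_; _≢_)
open import Relation.Nullary using (¬_)
open import Function.Definitions using (Injective)

-- A directed graph on vertex set Fin n with integer edge weights in {1,…,M}:
-- G u w = nothing  : no edge u → w
-- G u w = just k   : edge u → w of weight suc (toℕ k) ∈ {1,…,M}
Graph : ℕ → ℕ → Set
Graph n M = Fin n → Fin n → Maybe (Fin M)

data Walk {n M : ℕ} (G : Graph n M) : Fin n → Fin n → Set where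
  []   : ∀ {u} → Walk G u u
  step : ∀ {u w v} (k : Fin M) → G u w ≡ just k → Walk G w v → Walk G u v

module _ {n M : ℕ} {G : Graph n M} where

  weight : ∀ {u v} → Walk G u v → ℕ
  weight []              = 0
  weight (step k _ p)    = suc (toℕ k) + weight p

  hops : ∀ {u v} → Walk G u v → ℕ
  hops []             = 0
  hops (step _ _ p)   = suc (hops p)

  verts : ∀ {u v} → Walk G u v → List (Fin n)
  verts {u} []                 = u ∷ []
  verts {u} (step _ _ p)       = u ∷ verts p

  IsShortest : ∀ {u v} → Walk G u v → Set
  IsShortest {u} {v} p = (q : Walk G u v) → weight p ≤ weight q

  Internal : ∀ {u v} → Fin n → Walk G u v → Set
  Internal {u} {v} z p = z ∈ verts p × z ≢ u × z ≢ v

-- the event "for every u, v with 2 ≤ |uv| < ∞ there is a shortest path ρ'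
-- and an internal vertex z of ρ' with π(z) ≤ C·M·n·log n / ‖uv‖",
-- where π(z) = toℕ (π z) + 1 ∈ [n], ‖uv‖ = weight ρ', and the division is
-- cleared (‖uv‖ > 0).  2 ≤ |uv| < ∞ means: some shortest path from u to v
-- has at least 2 edges.
Good : ∀ {n M} → Graph n M → ℕ → (Fin n → Fin n) → Set
Good {n} {M} G C π =
  ∀ u v →
  (Σ (Walk G u v) λ p → IsShortest p × 2 ≤ hops p) →
  Σ (Walk G u v) λ p' → IsShortest p' ×
    ∃ λ z → Internal z p' ×
      suc (toℕ (π z)) * weight p' ≤ C * M * n * ⌊log₂ n ⌋

Distinct : ∀ {n} → (Fin n → Fin n) → (Fin n → Fin n) → Set
Distinct {n} π σ = ∃ λ (x : Fin n) → π x ≢ σ x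

-- Probability statement: among the n! bijections π : V → [n], the set of
-- "bad" ones has size at most n!/n^c.
BadFractionAtMost : ℕ → (n M : ℕ) → Graph n M → ℕ → Set
BadFractionAtMost c n M G C =
  (πs : List (Fin n → Fin n)) →
  All (Injective _≡_ _≡_) πs →
  AllPairs Distinct πs →
  All (λ π → ¬ Good G C π) πs →
  length πs * n ^ c ≤ n !

-- Fix, independently of π, one shortest path ρ(u, v) with k ≥ 1 interior vertices and weight
-- w ≤ M (k + 1) for every pair with 2 ≤ |uv| < ∞.  A bijection π fails at (u, v) only if all k
-- interior vertices receive values ≥ t, where t·w ≤ C M n log n; there are (n − t)↓k · (n − k)!
-- such π.  Taking t ≈ n R / k with R = 2(2 + c) log n, Bernoulli's inequality gives
-- (1 − t/n)^(k/R) ≤ 1/2, so (n − t)↓k ≤ n↓k · 2^(−R) ≤ n↓k / n^(2+c), i.e. at most n!/n^(2+c)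
-- bad π per pair, and a union bound over the n² pairs leaves n!/n^c.  The counting is done
-- constructively: distinct bijections give distinct tables of values, which are counted entry
-- by entry by splitting on the first entry.

module Submission where

open import Defs
open import Data.Nat
open import Data.Nat.Properties
open import Data.Nat.DivMod
open import Data.Nat.Logarithm using (⌊log₂_⌋; ⌊log₂⌋-mono-≤; ⌊log₂[2^n]⌋≡n)
open import Data.Nat.Solver using (module +-*-Solver)
open import Data.Fin using (Fin; toℕ)
import Data.Fin.Properties as Fin
open import Data.Maybe using (Maybe; just; nothing)
import Data.Maybe.Properties as Maybe
open import Data.List using (List; []; _∷_; length; map; _++_; filter; allFin; replicate; applyUpTo; head; drop; concatMap)
open import Data.List.Properties
  using (length-removeAt′; length-map; length-applyUpTo; length-++; length-tabulate; map-++; ∷-injectiveˡ; ∷-injectiveʳ)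
open import Data.List.Relation.Unary.All as All using (All; []; _∷_)
import Data.List.Relation.Unary.All.Properties as All
open import Data.List.Relation.Unary.Any as Any using (Any; here; there)
import Data.List.Relation.Unary.Any.Properties as Any
open import Data.List.Relation.Unary.AllPairs as AllPairs using (AllPairs; []; _∷_)
import Data.List.Relation.Unary.AllPairs.Properties as AllPairs
open import Data.List.Relation.Unary.Unique.Propositional using (Unique)
import Data.List.Relation.Unary.Unique.Propositional.Properties as Unique
open import Data.List.Relation.Binary.Pointwise as Pointwise using (Pointwise; []; _∷_)
open import Data.List.Relation.Binary.Subset.Propositional using (_⊆_)
open import Data.List.Membership.Propositional using (_∈_; _∉_)
open import Data.List.Membership.Propositional.Properties
  using (∈-map⁻; ∈-applyUpTo⁺; ∈-filter⁺; ∈-filter⁻; ∈-allFin; ∈-++⁺ˡ; ∈-++⁺ʳ)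
open import Data.Product using (Σ; ∃; _×_; _,_; proj₁; proj₂)
open import Data.Empty using (⊥; ⊥-elim)
open import Function.Definitions using (Injective)
open import Relation.Binary.PropositionalEquality
open import Relation.Nullary using (Dec; yes; no; ¬_; ¬?)
open import Relation.Nullary.Decidable using (_×-dec_)
open import Relation.Unary using (Decidable)
open import Relation.Unary.Properties using (∁?)

open import Algebra.Properties.CommutativeSemigroup *-commutativeSemigroup using (interchange; xy∙z≈xz∙y)

open +-*-Solver using (solve; _:=_; _:+_; _:*_; con)

-- Counting distinct lists

module _ {A : Set} where

  private
    ∈-─ : ∀ {x y : A} {xs} (x∈xs : x ∈ xs) → y ∈ xs → y ≢ x → y ∈ (xs Any.─ x∈xs)
    ∈-─ (here refl) (here refl) y≢x = ⊥-elim (y≢x refl)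
    ∈-─ (here _)    (there y∈xs) _  = y∈xs
    ∈-─ (there _)   (here refl)  _  = here refl
    ∈-─ (there x∈xs) (there y∈xs) y≢x = there (∈-─ x∈xs y∈xs y≢x)

  ∉⇒All≢ : ∀ {x : A} {xs} → x ∉ xs → All (x ≢_) xs
  ∉⇒All≢ x∉xs = All.tabulate (λ y∈xs x≡y → x∉xs (subst (_∈ _) (sym x≡y) y∈xs))

  Unique-⊆⇒length≤ : ∀ {xs ys : List A} → Unique xs → xs ⊆ ys → length xs ≤ length ys
  Unique-⊆⇒length≤ [] _ = z≤n
  Unique-⊆⇒length≤ {x ∷ xs} {ys} (x∉xs ∷ xs!) xs⊆ys = begin
      suc (length xs)              ≤⟨ s≤s (Unique-⊆⇒length≤ xs! xs⊆ys─x) ⟩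
      suc (length (ys Any.─ x∈ys)) ≡⟨ sym (length-removeAt′ ys (Any.index x∈ys)) ⟩
      length ys                    ∎
    where
      open ≤-Reasoning
      x∈ys = xs⊆ys (here refl)
      xs⊆ys─x : xs ⊆ (ys Any.─ x∈ys)
      xs⊆ys─x y∈xs = ∈-─ x∈ys (xs⊆ys (there y∈xs)) (λ y≡x → All.lookup x∉xs y∈xs (sym y≡x))

  head-drop₁-injective : ∀ {xs ys : List A} → head xs ≡ head ys → drop 1 xs ≡ drop 1 ys → xs ≡ ys
  head-drop₁-injective {[]}    {[]}    _  _  = refl
  head-drop₁-injective {_ ∷ _} {_ ∷ _} hd tl = cong₂ _∷_ (Maybe.just-injective hd) tl

  AllPairs-replicate : ∀ {R : A → A → Set} {x} k → R x x → AllPairs R (replicate k x)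
  AllPairs-replicate zero    _   = []
  AllPairs-replicate (suc k) Rxx = All.replicate⁺ k Rxx ∷ AllPairs-replicate k Rxx

  map-≡⇒≡ : ∀ {B : Set} {f g : A → B} {xs x} → map f xs ≡ map g xs → x ∈ xs → f x ≡ g x
  map-≡⇒≡ {xs = _ ∷ _} eq (here refl)  = ∷-injectiveˡ eq
  map-≡⇒≡ {xs = _ ∷ _} eq (there x∈xs) = map-≡⇒≡ (∷-injectiveʳ eq) x∈xs

  Unique-map-drop₁ : ∀ {h : A} {yss} → All (λ ys → head ys ≡ just h) yss → Unique yss →
                     Unique (map (drop 1) yss)
  Unique-map-drop₁ []          []            = []
  Unique-map-drop₁ (hd ∷ hds) (ys∉yss ∷ yss!) =
    All.map⁺ (All.zipWith (λ (hd′ , ys≢zs) tl → ys≢zs (head-drop₁-injective (trans hd (sym hd′)) tl)) (hds , ys∉yss))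
    ∷ Unique-map-drop₁ hds yss!

  length-filter+filter-∁ : ∀ {P : A → Set} (P? : Decidable P) xs →
                           length xs ≡ length (filter P? xs) + length (filter (∁? P?) xs)
  length-filter+filter-∁ P? [] = refl
  length-filter+filter-∁ P? (x ∷ xs) with P? x
  ... | yes _ = cong suc (length-filter+filter-∁ P? xs)
  ... | no _  = trans (cong suc (length-filter+filter-∁ P? xs)) (sym (+-suc _ _))

module _ {A K : Set} {R : A → A → Set} {P : A → Set}
         (Q : K → A → Set) (Q? : ∀ k → Decidable (Q k)) (D B : ℕ)
         (fibre-bound : ∀ k ys → AllPairs R ys → All P ys → All (Q k) ys → length ys * D ≤ B) where

  union-bound : ∀ ks xs → AllPairs R xs → All P xs → All (λ x → Any (λ k → Q k x) ks) xs →
                length xs * D ≤ length ks * B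
  union-bound []       []      _     _     _          = z≤n
  union-bound []       (_ ∷ _) _     _     (() ∷ _)
  union-bound (k ∷ ks) xs      R-xs  P-xs  some-Q-xs = begin
      length xs * D                          ≡⟨ cong (_* D) (length-filter+filter-∁ (Q? k) xs) ⟩
      (length inK + length notK) * D         ≡⟨ *-distribʳ-+ D (length inK) (length notK) ⟩
      length inK * D + length notK * D       ≤⟨ +-mono-≤ bound-inK bound-notK ⟩
      B + length ks * B                      ∎
    where
      open ≤-Reasoning
      inK = filter (Q? k) xs
      notK = filter (∁? (Q? k)) xs
      bound-inK : length inK * D ≤ B
      bound-inK = fibre-bound k inK (AllPairs.filter⁺ (Q? k) R-xs) (All.filter⁺ (Q? k) P-xs) (All.all-filter (Q? k) xs)
      other-key : All (λ x → Any (λ k′ → Q k′ x) ks) notK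
      other-key = All.zipWith (λ { (¬q , here q) → ⊥-elim (¬q q) ; (_ , there q) → q })
                    (All.all-filter (∁? (Q? k)) xs , All.filter⁺ (∁? (Q? k)) some-Q-xs)
      bound-notK : length notK * D ≤ length ks * B
      bound-notK = union-bound ks notK (AllPairs.filter⁺ (∁? (Q? k)) R-xs) (All.filter⁺ (∁? (Q? k)) P-xs) other-key

Unique-≥⇒length≤n∸t : ∀ {n} t {xs : List (Fin n)} → Unique xs → All (λ x → t ≤ toℕ x) xs → length xs ≤ n ∸ t
Unique-≥⇒length≤n∸t {n} t {xs} xs! t≤xs = begin
    length xs                          ≡⟨ length-map toℕ xs ⟨
    length (map toℕ xs)                ≤⟨ Unique-⊆⇒length≤ (Unique.map⁺ Fin.toℕ-injective xs!) ⊆range ⟩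
    length (applyUpTo (t +_) (n ∸ t))  ≡⟨ length-applyUpTo (t +_) (n ∸ t) ⟩
    n ∸ t                              ∎
  where
    open ≤-Reasoning
    ⊆range : map toℕ xs ⊆ applyUpTo (t +_) (n ∸ t)
    ⊆range y∈ with ∈-map⁻ toℕ y∈
    ... | x , x∈xs , refl = subst (_∈ applyUpTo (t +_) (n ∸ t)) (m+[n∸m]≡n t≤x)
                                  (∈-applyUpTo⁺ (t +_) (∸-monoˡ-< (Fin.toℕ<n x) t≤x))
      where t≤x = All.lookup t≤xs x∈xs

-- Falling factorials and the choice of threshold

falling : ℕ → ℕ → ℕ → ℕ
falling a p zero    = 1
falling a p (suc k) = (a ∸ p) * falling a (suc p) k

falling-shift : ∀ a k p j → falling a (k + p) j ≡ falling (a ∸ k) p j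
falling-shift a k p zero    = refl
falling-shift a k p (suc j) =
  cong₂ _*_ (sym (∸-+-assoc a k p))
            (trans (cong (λ q → falling a q j) (sym (+-suc k p))) (falling-shift a k (suc p) j))

falling-+ : ∀ a p k j → falling a p (k + j) ≡ falling a p k * falling a (k + p) j
falling-+ a p zero    j = sym (+-identityʳ _)
falling-+ a p (suc k) j = begin
    (a ∸ p) * falling a (suc p) (k + j)
      ≡⟨ cong ((a ∸ p) *_) (falling-+ a (suc p) k j) ⟩
    (a ∸ p) * (falling a (suc p) k * falling a (k + suc p) j)
      ≡⟨ *-assoc (a ∸ p) _ _ ⟨
    (a ∸ p) * falling a (suc p) k * falling a (k + suc p) j
      ≡⟨ cong (λ q → (a ∸ p) * falling a (suc p) k * falling a q j) (+-suc k p) ⟩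
    (a ∸ p) * falling a (suc p) k * falling a (suc k + p) j
      ∎
  where open ≡-Reasoning

falling≡! : ∀ a → falling a 0 a ≡ a !
falling≡! zero    = refl
falling≡! (suc a) = cong (suc a *_) (trans (falling-shift (suc a) 1 0 a) (falling≡! a))

falling≤! : ∀ a j → falling a 0 j ≤ a !
falling≤! a       zero    = 1≤n! a
falling≤! zero    (suc j) = z≤n
falling≤! (suc a) (suc j) =
  *-monoʳ-≤ (suc a) (subst (_≤ a !) (sym (falling-shift (suc a) 1 0 j)) (falling≤! a j))

!≡falling*! : ∀ {n k} → k ≤ n → n ! ≡ falling n 0 k * (n ∸ k) !
!≡falling*! {n} {k} k≤n = begin
    n !                                      ≡⟨ sym (falling≡! n) ⟩
    falling n 0 n                            ≡⟨ cong (falling n 0) (sym (m+[n∸m]≡n k≤n)) ⟩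
    falling n 0 (k + (n ∸ k))                ≡⟨ falling-+ n 0 k (n ∸ k) ⟩
    falling n 0 k * falling n (k + 0) (n ∸ k) ≡⟨ cong (falling n 0 k *_) (falling-shift n k 0 (n ∸ k)) ⟩
    falling n 0 k * falling (n ∸ k) 0 (n ∸ k) ≡⟨ cong (falling n 0 k *_) (falling≡! (n ∸ k)) ⟩
    falling n 0 k * (n ∸ k) !                ∎
  where open ≡-Reasoning

falling-ratio : ∀ {a n} p k → a ≤ n → falling a p k * n ^ k ≤ a ^ k * falling n p k
falling-ratio p zero    _   = ≤-refl
falling-ratio {a} {n} p (suc k) a≤n = begin
    (a ∸ p) * falling a (suc p) k * (n * n ^ k)   ≡⟨ interchange (a ∸ p) (falling a (suc p) k) n (n ^ k) ⟩
    ((a ∸ p) * n) * (falling a (suc p) k * n ^ k) ≤⟨ *-mono-≤ [a∸p]*n≤a*[n∸p] (falling-ratio (suc p) k a≤n) ⟩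
    (a * (n ∸ p)) * (a ^ k * falling n (suc p) k) ≡⟨ interchange a (n ∸ p) (a ^ k) (falling n (suc p) k) ⟩
    (a * a ^ k) * ((n ∸ p) * falling n (suc p) k) ∎
  where
    open ≤-Reasoning
    [a∸p]*n≤a*[n∸p] : (a ∸ p) * n ≤ a * (n ∸ p)
    [a∸p]*n≤a*[n∸p] = begin
      (a ∸ p) * n   ≡⟨ *-distribʳ-∸ n a p ⟩
      a * n ∸ p * n ≤⟨ ∸-monoʳ-≤ (a * n) (*-monoʳ-≤ p a≤n) ⟩
      a * n ∸ p * a ≡⟨ cong (a * n ∸_) (*-comm p a) ⟩
      a * n ∸ a * p ≡⟨ sym (*-distribˡ-∸ a n p) ⟩
      a * (n ∸ p)   ∎

falling-0≡0 : ∀ {k} → 1 ≤ k → falling 0 0 k ≡ 0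
falling-0≡0 {suc _} _ = refl

falling-decay : ∀ {a n k D} .{{_ : NonZero n}} → a ≤ n → a ^ k * n ^ D ≤ n ^ k → falling a 0 k * n ^ D ≤ falling n 0 k
falling-decay {a} {n} {k} {D} a≤n a^k*n^D≤n^k =
  *-cancelʳ-≤ _ _ (n ^ k) {{m^n≢0 n k}} (begin
    falling a 0 k * n ^ D * n ^ k ≡⟨ xy∙z≈xz∙y (falling a 0 k) (n ^ D) (n ^ k) ⟩
    falling a 0 k * n ^ k * n ^ D ≤⟨ *-monoˡ-≤ (n ^ D) (falling-ratio 0 k a≤n) ⟩
    a ^ k * falling n 0 k * n ^ D ≡⟨ xy∙z≈xz∙y (a ^ k) (falling n 0 k) (n ^ D) ⟩
    a ^ k * n ^ D * falling n 0 k ≤⟨ *-monoˡ-≤ (falling n 0 k) a^k*n^D≤n^k ⟩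
    n ^ k * falling n 0 k         ≡⟨ *-comm (n ^ k) (falling n 0 k) ⟩
    falling n 0 k * n ^ k         ∎)
  where open ≤-Reasoning

bernoulli : ∀ a b j → a ^ suc j + suc j * b * a ^ j ≤ (a + b) ^ suc j
bernoulli a b zero    = ≤-reflexive (solve 2 (λ a b → a :* con 1 :+ (b :+ con 0) :* con 1 := (a :+ b) :* con 1) refl a b)
bernoulli a b (suc j) = begin
    a * (a * X) + suc (suc j) * b * (a * X)                        ≤⟨ m≤m+n _ (suc j * b * b * X) ⟩
    a * (a * X) + suc (suc j) * b * (a * X) + suc j * b * b * X
      ≡⟨ solve 4 (λ a b X J → a :* (a :* X) :+ (con 1 :+ J) :* b :* (a :* X) :+ J :* b :* b :* X
                              := (a :+ b) :* (a :* X :+ J :* b :* X)) refl a b X (suc j) ⟩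
    (a + b) * (a * X + suc j * b * X)                              ≤⟨ *-monoʳ-≤ (a + b) (bernoulli a b j) ⟩
    (a + b) * (a + b) ^ suc j                                      ∎
  where
    open ≤-Reasoning
    X = a ^ j

[n∸t]^m*2≤n^m : ∀ n t m → .{{NonZero m}} → n ≤ m * t → (n ∸ t) ^ m * 2 ≤ n ^ m
[n∸t]^m*2≤n^m n t (suc j) n≤m*t with t ≤? n
... | no t≰n = subst (λ a → a ^ suc j * 2 ≤ n ^ suc j) (sym (m≤n⇒m∸n≡0 (<⇒≤ (≰⇒> t≰n)))) z≤n
... | yes t≤n = begin
    a ^ suc j * 2                 ≡⟨ *-comm (a ^ suc j) 2 ⟩
    a * a ^ j + (a * a ^ j + 0)   ≡⟨ cong (a * a ^ j +_) (+-identityʳ (a * a ^ j)) ⟩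
    a * a ^ j + a * a ^ j         ≤⟨ +-monoʳ-≤ (a * a ^ j) (*-monoˡ-≤ (a ^ j) (≤-trans (m∸n≤m n t) n≤m*t)) ⟩
    a ^ suc j + suc j * t * a ^ j ≤⟨ bernoulli a t j ⟩
    (a + t) ^ suc j               ≡⟨ cong (_^ suc j) (m∸n+n≡m t≤n) ⟩
    n ^ suc j                     ∎
  where
    open ≤-Reasoning
    a = n ∸ t

x*2≤y⇒x^R*2^R≤y^R : ∀ {x y} R → x * 2 ≤ y → x ^ R * 2 ^ R ≤ y ^ R
x*2≤y⇒x^R*2^R≤y^R zero    _ = ≤-refl
x*2≤y⇒x^R*2^R≤y^R {x} {y} (suc R) x*2≤y = begin
    x * x ^ R * (2 * 2 ^ R)   ≡⟨ interchange x (x ^ R) 2 (2 ^ R) ⟩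
    (x * 2) * (x ^ R * 2 ^ R) ≤⟨ *-mono-≤ x*2≤y (x*2≤y⇒x^R*2^R≤y^R R x*2≤y) ⟩
    y * y ^ R                 ∎
  where open ≤-Reasoning

a^k*2^R≤n^k : ∀ {a n} m R k → a ≤ n → a ^ m * 2 ≤ n ^ m → m * R ≤ k → a ^ k * 2 ^ R ≤ n ^ k
a^k*2^R≤n^k {a} {n} m R k a≤n a^m*2≤n^m m*R≤k = begin
    a ^ k * 2 ^ R                 ≡⟨ cong (λ e → a ^ e * 2 ^ R) (sym (m+[n∸m]≡n m*R≤k)) ⟩
    a ^ (m * R + r) * 2 ^ R       ≡⟨ cong (_* 2 ^ R) (^-distribˡ-+-* a (m * R) r) ⟩
    a ^ (m * R) * a ^ r * 2 ^ R   ≡⟨ cong (λ z → z * a ^ r * 2 ^ R) (sym (^-*-assoc a m R)) ⟩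
    (a ^ m) ^ R * a ^ r * 2 ^ R   ≡⟨ xy∙z≈xz∙y ((a ^ m) ^ R) (a ^ r) (2 ^ R) ⟩
    (a ^ m) ^ R * 2 ^ R * a ^ r   ≤⟨ *-mono-≤ (x*2≤y⇒x^R*2^R≤y^R R a^m*2≤n^m) (^-monoˡ-≤ r a≤n) ⟩
    (n ^ m) ^ R * n ^ r           ≡⟨ cong (_* n ^ r) (^-*-assoc n m R) ⟩
    n ^ (m * R) * n ^ r           ≡⟨ sym (^-distribˡ-+-* n (m * R) r) ⟩
    n ^ (m * R + r)               ≡⟨ cong (n ^_) (m+[n∸m]≡n m*R≤k) ⟩
    n ^ k                         ∎
  where
    open ≤-Reasoning
    r = k ∸ m * R

n<2^[1+⌊log₂n⌋] : ∀ n → n < 2 ^ suc ⌊log₂ n ⌋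
n<2^[1+⌊log₂n⌋] n = ≰⇒> λ 2^[1+L]≤n →
  1+n≰n (subst (_≤ ⌊log₂ n ⌋) (⌊log₂[2^n]⌋≡n (suc ⌊log₂ n ⌋)) (⌊log₂⌋-mono-≤ 2^[1+L]≤n))

n≤2^[2*⌊log₂n⌋] : ∀ {n} → 2 ≤ n → n ≤ 2 ^ (2 * ⌊log₂ n ⌋)
n≤2^[2*⌊log₂n⌋] {n} 2≤n = ≤-trans (<⇒≤ (n<2^[1+⌊log₂n⌋] n)) (^-monoʳ-≤ 2 1+L≤2*L)
  where
    L = ⌊log₂ n ⌋
    1+L≤2*L : suc L ≤ 2 * L
    1+L≤2*L = subst (suc L ≤_) (cong (L +_) (sym (+-identityʳ L))) (+-monoˡ-≤ L (⌊log₂⌋-mono-≤ {2} {n} 2≤n))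

-- m = ⌊k / R⌋ interior vertices already shrink (n ∸ t)^m / n^m by half once m t ≥ n, and the
-- k ≥ R m interior vertices contain R such blocks.
module Threshold (c L : ℕ) .{{_ : NonZero L}} {n M k w : ℕ}
                 (n≤2^2L : n ≤ 2 ^ (2 * L)) (1≤k : 1 ≤ k) (k≤n : k ≤ n) (w≤M*[1+k] : w ≤ M * suc k) where

  D = 2 + c
  R = 2 * L * D

  Threshold : ℕ → Set
  Threshold t = t * w ≤ 16 * D * M * n * L × falling (n ∸ t) 0 k * n ^ D ≤ falling n 0 k

  threshold-short : k < R → Threshold n
  threshold-short k<R = n*w≤ , subst (_≤ falling n 0 k) (sym 0↓k*n^D≡0) z≤n
    where
      open ≤-Reasoning
      n*w≤ : n * w ≤ 16 * D * M * n * L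
      n*w≤ = begin
        n * w       ≤⟨ *-monoʳ-≤ n (≤-trans w≤M*[1+k] (*-monoʳ-≤ M k<R)) ⟩
        n * (M * R) ≤⟨ m≤n*m (n * (M * R)) 8 ⟩
        8 * (n * (M * R)) ≡⟨ solve 4 (λ n M L c → con 8 :* (n :* (M :* (con 2 :* L :* (con 2 :+ c))))
                                 := con 16 :* (con 2 :+ c) :* M :* n :* L) refl n M L c ⟩
        16 * D * M * n * L ∎
      0↓k*n^D≡0 : falling (n ∸ n) 0 k * n ^ D ≡ 0
      0↓k*n^D≡0 = cong (_* n ^ D) (trans (cong (λ a → falling a 0 k) (n∸n≡0 n)) (falling-0≡0 1≤k))

  threshold-long : R ≤ k → ∃ Threshold
  threshold-long R≤k = t , t*w≤ , falling-decay {k = k} {D} {{n≢0}} (m∸n≤m n t) [n∸t]^k*n^D≤n^k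
    where
      instance
        R≢0 : NonZero R
        R≢0 = m*n≢0 (2 * L) D {{m*n≢0 2 L}}
      m = k / R
      instance
        m≢0 : NonZero m
        m≢0 = >-nonZero (m≥n⇒m/n>0 R≤k)
      t = suc (n / m)
      n≢0 : NonZero n
      n≢0 = >-nonZero (≤-trans 1≤k k≤n)
      open ≤-Reasoning
      n≤m*t : n ≤ m * t
      n≤m*t = begin
        n                 ≡⟨ m≡m%n+[m/n]*n n m ⟩
        n % m + n / m * m ≤⟨ +-monoˡ-≤ (n / m * m) (<⇒≤ (m%n<n n m)) ⟩
        m + n / m * m     ≡⟨ *-comm t m ⟩
        m * t             ∎
      t*m≤n+n : t * m ≤ n + n
      t*m≤n+n = +-mono-≤ (≤-trans (m/n≤m k R) k≤n) (m/n*n≤m n m)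
      k≤2*R*m : k ≤ 2 * R * m
      k≤2*R*m = begin
        k               ≡⟨ m≡m%n+[m/n]*n k R ⟩
        k % R + m * R   ≤⟨ +-monoˡ-≤ (m * R) (<⇒≤ (m%n<n k R)) ⟩
        R + m * R       ≤⟨ +-monoˡ-≤ (m * R) (m≤m*n R m) ⟩
        R * m + m * R   ≡⟨ solve 2 (λ R m → R :* m :+ m :* R := con 2 :* R :* m) refl R m ⟩
        2 * R * m       ∎
      t*w≤ : t * w ≤ 16 * D * M * n * L
      t*w≤ = begin
        t * w                       ≤⟨ *-monoʳ-≤ t w≤M*[1+k] ⟩
        t * (M * (1 + k))           ≤⟨ *-monoʳ-≤ t (*-monoʳ-≤ M (+-monoˡ-≤ k 1≤k)) ⟩
        t * (M * (k + k))           ≤⟨ *-monoʳ-≤ t (*-monoʳ-≤ M (+-mono-≤ k≤2*R*m k≤2*R*m)) ⟩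
        t * (M * (2 * R * m + 2 * R * m)) ≡⟨ solve 4 (λ t M R m → t :* (M :* (con 2 :* R :* m :+ con 2 :* R :* m))
                                                        := con 4 :* M :* R :* (t :* m)) refl t M R m ⟩
        4 * M * R * (t * m)         ≤⟨ *-monoʳ-≤ (4 * M * R) t*m≤n+n ⟩
        4 * M * R * (n + n)         ≡⟨ solve 4 (λ n M L c → con 4 :* M :* (con 2 :* L :* (con 2 :+ c)) :* (n :+ n)
                                                  := con 16 :* (con 2 :+ c) :* M :* n :* L) refl n M L c ⟩
        16 * D * M * n * L          ∎
      [n∸t]^k*n^D≤n^k : (n ∸ t) ^ k * n ^ D ≤ n ^ k
      [n∸t]^k*n^D≤n^k = begin
        (n ∸ t) ^ k * n ^ D ≤⟨ *-monoʳ-≤ ((n ∸ t) ^ k) (^-monoˡ-≤ D n≤2^2L) ⟩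
        (n ∸ t) ^ k * (2 ^ (2 * L)) ^ D ≡⟨ cong ((n ∸ t) ^ k *_) (^-*-assoc 2 (2 * L) D) ⟩
        (n ∸ t) ^ k * 2 ^ R ≤⟨ a^k*2^R≤n^k m R k (m∸n≤m n t) ([n∸t]^m*2≤n^m n t m n≤m*t) (m/n*n≤m k R) ⟩
        n ^ k               ∎

  threshold : ∃ Threshold
  threshold with R ≤? k
  ... | yes R≤k = threshold-long R≤k
  ... | no  R≰k = n , threshold-short (≰⇒> R≰k)

m*n^[2+c]≤n*[n*o]⇒m*n^c≤o : ∀ m {n} c {o} → .{{NonZero n}} → m * n ^ (2 + c) ≤ n * (n * o) → m * n ^ c ≤ o
m*n^[2+c]≤n*[n*o]⇒m*n^c≤o m {n} c {o} le = *-cancelʳ-≤ (m * n ^ c) o (n * n) {{m*n≢0 n n}} (begin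
    m * n ^ c * (n * n) ≡⟨ solve 3 (λ m n p → m :* p :* (n :* n) := m :* (n :* (n :* p))) refl m n (n ^ c) ⟩
    m * n ^ (2 + c)     ≤⟨ le ⟩
    n * (n * o)         ≡⟨ solve 2 (λ n o → n :* (n :* o) := o :* (n :* n)) refl n o ⟩
    o * (n * n)         ∎)
  where open ≤-Reasoning

-- Injective tables above thresholds

module Arrangements (n : ℕ) where

  open import Data.List.Membership.DecPropositional (Fin._≟_ {n}) using (_∈?_)

  Above : List ℕ → List (Fin n) → Set
  Above = Pointwise (λ t y → t ≤ toℕ y)

  Arrangement : List (Fin n) → List ℕ → List (Fin n) → Set
  Arrangement P ts ys = Unique ys × All (_∉ P) ys × Above ts ys

  -- ∏ᵢ (n ∸ tᵢ ∸ (p + i)): the i-th entry avoids the p + i values already used, all of which are ≥ tᵢ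
  arrangements : ℕ → List ℕ → ℕ
  arrangements p []       = 1
  arrangements p (t ∷ ts) = (n ∸ t ∸ p) * arrangements (suc p) ts

  StartsWith : Fin n → List (Fin n) → Set
  StartsWith h ys = head ys ≡ just h

  length≤arrangements :
    ∀ ts P → Unique P → All (λ t → All (λ x → t ≤ toℕ x) P) ts → AllPairs _≥_ ts →
    ∀ yss → Unique yss → All (Arrangement P ts) yss → length yss ≤ arrangements (length P) ts
  length≤arrangements [] _ _ _ _ []          _ _ = z≤n
  length≤arrangements [] _ _ _ _ (_ ∷ [])    _ _ = s≤s z≤n
  length≤arrangements [] _ _ _ _ (_ ∷ _ ∷ _) ((ys≢zs ∷ _) ∷ _) ((_ , _ , []) ∷ (_ , _ , []) ∷ _) = ⊥-elim (ys≢zs refl)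
  length≤arrangements (t ∷ ts) P P! (t≤P ∷ ts≤P) (t≥ts ∷ ts↓) yss yss! arr = begin
      length yss              ≡⟨ *-identityʳ (length yss) ⟨
      length yss * 1          ≤⟨ union-bound StartsWith (λ h ys → Maybe.≡-dec Fin._≟_ (head ys) (just h)) 1 B fibre
                                             heads yss yss! arr (All.map starts-in-heads arr) ⟩
      length heads * B        ≤⟨ *-monoˡ-≤ B length-heads ⟩
      (n ∸ t ∸ length P) * B  ∎
    where
      open ≤-Reasoning
      B = arrangements (suc (length P)) ts
      isHead? = λ (h : Fin n) → (t ≤? toℕ h) ×-dec ¬? (h ∈? P)
      heads = filter isHead? (allFin n)

      heads++P! : Unique (heads ++ P)
      heads++P! = Unique.++⁺ (Unique.filter⁺ isHead? (Unique.allFin⁺ n)) P!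
                    (λ (h∈heads , h∈P) → proj₂ (proj₂ (∈-filter⁻ isHead? {xs = allFin n} h∈heads)) h∈P)

      length-heads : length heads ≤ n ∸ t ∸ length P
      length-heads = m+n≤o⇒m≤o∸n (length heads) (subst (_≤ n ∸ t) (length-++ heads)
        (Unique-≥⇒length≤n∸t t heads++P! (All.++⁺ (All.map proj₁ (All.all-filter isHead? (allFin n))) t≤P)))

      starts-in-heads : ∀ {ys} → Arrangement P (t ∷ ts) ys → Any (λ h → StartsWith h ys) heads
      starts-in-heads (_ , y∉P ∷ _ , t≤y ∷ _) = Any.map (cong just) (∈-filter⁺ isHead? (∈-allFin _) (t≤y , y∉P))

      fibre : ∀ h zss → Unique zss → All (Arrangement P (t ∷ ts)) zss → All (StartsWith h) zss → length zss * 1 ≤ B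
      fibre h [] _ _ _ = z≤n
      fibre h zss@((y ∷ _) ∷ _) zss! arr@((_ , y∉P ∷ _ , t≤y ∷ _) ∷ _) starts@(refl ∷ _) = begin
          length zss * 1                  ≡⟨ *-identityʳ (length zss) ⟩
          length zss                      ≡⟨ length-map (drop 1) zss ⟨
          length (map (drop 1) zss)       ≤⟨ length≤arrangements ts (y ∷ P) (∉⇒All≢ y∉P ∷ P!) ts≤yP ts↓
                                               (map (drop 1) zss) (Unique-map-drop₁ starts zss!)
                                               (All.map⁺ (All.zipWith tail-arrangement (starts , arr))) ⟩
          B                               ∎
        where
          ts≤yP : All (λ t′ → All (λ x → t′ ≤ toℕ x) (y ∷ P)) ts
          ts≤yP = All.zipWith (λ (t′≤t , t′≤P) → ≤-trans t′≤t t≤y ∷ t′≤P) (t≥ts , ts≤P)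
          tail-arrangement : ∀ {zs} → StartsWith y zs × Arrangement P (t ∷ ts) zs → Arrangement (y ∷ P) ts (drop 1 zs)
          tail-arrangement {_ ∷ _} (refl , (y∉zs ∷ zs!) , (_ ∷ zs∉P) , (_ ∷ ts≤zs)) =
            zs! , All.zipWith fresh (y∉zs , zs∉P) , ts≤zs
            where
              fresh : ∀ {z} → y ≢ z × z ∉ P → z ∉ y ∷ P
              fresh (y≢z , _)   (here z≡y)  = y≢z (sym z≡y)
              fresh (_   , z∉P) (there z∈P) = z∉P z∈P

  arrangements-replicate : ∀ t p k ts → arrangements p (replicate k t ++ ts) ≡ falling (n ∸ t) p k * arrangements (k + p) ts
  arrangements-replicate t p zero    ts = sym (+-identityʳ _)
  arrangements-replicate t p (suc k) ts = begin
      (n ∸ t ∸ p) * arrangements (suc p) (replicate k t ++ ts)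
        ≡⟨ cong ((n ∸ t ∸ p) *_) (arrangements-replicate t (suc p) k ts) ⟩
      (n ∸ t ∸ p) * (falling (n ∸ t) (suc p) k * arrangements (k + suc p) ts)
        ≡⟨ *-assoc (n ∸ t ∸ p) _ _ ⟨
      (n ∸ t ∸ p) * falling (n ∸ t) (suc p) k * arrangements (k + suc p) ts
        ≡⟨ cong (λ q → (n ∸ t ∸ p) * falling (n ∸ t) (suc p) k * arrangements q ts) (+-suc k p) ⟩
      (n ∸ t ∸ p) * falling (n ∸ t) (suc p) k * arrangements (suc k + p) ts
        ∎
    where open ≡-Reasoning

  arrangements-zeros : ∀ p j → arrangements p (replicate j 0) ≡ falling n p j
  arrangements-zeros p zero    = refl
  arrangements-zeros p (suc j) = cong ((n ∸ p) *_) (arrangements-zeros (suc p) j)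

  Above-replicate : ∀ {t} (π : Fin n → Fin n) {S} → All (λ z → t ≤ toℕ (π z)) S → Above (replicate (length S) t) (map π S)
  Above-replicate π []          = []
  Above-replicate π (t≤πz ∷ t≤πS) = t≤πz ∷ Above-replicate π t≤πS

  length≤injections-above : ∀ t {S : List (Fin n)} → Unique S →
    ∀ πs → AllPairs Distinct πs → All (Injective _≡_ _≡_) πs → All (λ π → All (λ z → t ≤ toℕ (π z)) S) πs →
    length πs ≤ falling (n ∸ t) 0 (length S) * (n ∸ length S) !
  length≤injections-above t {S} S! πs πs-distinct πs-inj πs-above = begin
      length πs
        ≡⟨ length-map table πs ⟨
      length (map table πs)
        ≤⟨ length≤arrangements ts [] [] (All.universal (λ _ → []) ts) ts↓ (map table πs) tables!
             (All.map⁺ (All.zipWith table-arrangement (πs-inj , πs-above))) ⟩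
      arrangements 0 ts
        ≡⟨ arrangements-replicate t 0 k (replicate j 0) ⟩
      falling (n ∸ t) 0 k * arrangements (k + 0) (replicate j 0)
        ≡⟨ cong (falling (n ∸ t) 0 k *_) (trans (arrangements-zeros (k + 0) j) (falling-shift n k 0 j)) ⟩
      falling (n ∸ t) 0 k * falling (n ∸ k) 0 j
        ≤⟨ *-monoʳ-≤ (falling (n ∸ t) 0 k) (falling≤! (n ∸ k) j) ⟩
      falling (n ∸ t) 0 k * (n ∸ k) !
        ∎
    where
      open ≤-Reasoning
      k = length S
      notInS? = λ (x : Fin n) → ¬? (x ∈? S)
      rest = filter notInS? (allFin n)
      j = length rest
      order = S ++ rest
      ts = replicate k t ++ replicate j 0

      order! : Unique order
      order! = Unique.++⁺ S! (Unique.filter⁺ notInS? (Unique.allFin⁺ n))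
                 (λ (x∈S , x∈rest) → proj₂ (∈-filter⁻ notInS? {xs = allFin n} x∈rest) x∈S)

      ∈-order : ∀ x → x ∈ order
      ∈-order x with x ∈? S
      ... | yes x∈S = ∈-++⁺ˡ x∈S
      ... | no  x∉S = ∈-++⁺ʳ S (∈-filter⁺ notInS? (∈-allFin x) x∉S)

      ts↓ : AllPairs _≥_ ts
      ts↓ = AllPairs.++⁺ (AllPairs-replicate k ≤-refl) (AllPairs-replicate j z≤n)
                         (All.universal (λ _ → All.replicate⁺ j z≤n) _)

      table : (Fin n → Fin n) → List (Fin n)
      table π = map π order

      tables! : Unique (map table πs)
      tables! = AllPairs.map⁺ (AllPairs.map (λ (x , πx≢σx) πs≡σs → πx≢σx (map-≡⇒≡ πs≡σs (∈-order x)))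
                                            πs-distinct)

      table-arrangement : ∀ {π} → Injective _≡_ _≡_ π × All (λ z → t ≤ toℕ (π z)) S → Arrangement [] ts (table π)
      table-arrangement {π} (π-inj , t≤πS) =
        Unique.map⁺ π-inj order! ,
        All.universal (λ _ ()) _ ,
        subst (Above ts) (sym (map-++ π S rest))
              (Pointwise.++⁺ (Above-replicate π t≤πS) (Above-replicate π (All.universal (λ _ → z≤n) rest)))

-- Shortest paths

module Paths {n M : ℕ} (G : Graph n M) where

  ShortestWithin : ∀ {u v} → ℕ → Walk G u v → Set
  ShortestWithin {u} {v} K p = (q : Walk G u v) → hops q ≤ K → weight p ≤ weight q

  end∈verts : ∀ {u v} (p : Walk G u v) → v ∈ verts p
  end∈verts []           = here refl
  end∈verts (step _ _ p) = there (end∈verts p)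

  suffix : ∀ {u v z} (p : Walk G u v) → z ∈ verts p →
           Σ (Walk G z v) λ q → weight q ≤ weight p × hops q ≤ hops p
  suffix []           (here refl)  = [] , ≤-refl , ≤-refl
  suffix (step k e p) (here refl)  = step k e p , ≤-refl , ≤-refl
  suffix (step k _ p) (there z∈p) with suffix p z∈p
  ... | q , wq≤wp , hq≤hp = q , ≤-trans wq≤wp (m≤n+m _ (suc (toℕ k))) , m≤n⇒m≤1+n hq≤hp

  ShortestWithin⇒Unique : ∀ {u v} K (p : Walk G u v) → hops p ≤ K → ShortestWithin K p → Unique (verts p)
  ShortestWithin⇒Unique K       []           _         _        = [] ∷ []
  ShortestWithin⇒Unique (suc K) (step k e p) (s≤s hp≤K) shortest =
    ∉⇒All≢ u∉p ∷ ShortestWithin⇒Unique K p hp≤K shortest-p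
    where
      shortest-p : ShortestWithin K p
      shortest-p q hq≤K = +-cancelˡ-≤ (suc (toℕ k)) _ _ (shortest (step k e q) (s≤s hq≤K))
      -- a return to the start would give a strictly lighter walk
      u∉p : _ ∉ verts p
      u∉p u∈p with suffix p u∈p
      ... | q , wq≤wp , hq≤hp = <-irrefl refl (begin-strict
          weight p                    <⟨ s≤s (m≤n+m (weight p) (toℕ k)) ⟩
          weight (step k e p)         ≤⟨ shortest q (m≤n⇒m≤1+n (≤-trans hq≤hp hp≤K)) ⟩
          weight q                    ≤⟨ wq≤wp ⟩
          weight p                    ∎)
        where open ≤-Reasoning

  Unique⇒hops<n : ∀ {u v} (p : Walk G u v) → Unique (verts p) → hops p < n
  Unique⇒hops<n p p! = subst₂ _≤_ (length-verts p) (length-tabulate (λ x → x))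
                         (Unique-⊆⇒length≤ p! (λ {x} _ → ∈-allFin x))
    where
      length-verts : ∀ {u v} (p : Walk G u v) → length (verts p) ≡ suc (hops p)
      length-verts []           = refl
      length-verts (step _ _ p) = cong suc (length-verts p)

  weight≤M*hops : ∀ {u v} (p : Walk G u v) → weight p ≤ M * hops p
  weight≤M*hops []           = z≤n
  weight≤M*hops (step k _ p) = ≤-trans (+-mono-≤ (Fin.toℕ<n k) (weight≤M*hops p)) (≤-reflexive (sym (*-suc M (hops p))))

  sources : ∀ {u v} → Walk G u v → List (Fin n)
  sources []               = []
  sources {u} (step _ _ p) = u ∷ sources p

  length-sources : ∀ {u v} (p : Walk G u v) → length (sources p) ≡ hops p
  length-sources []           = refl
  length-sources (step _ _ p) = cong suc (length-sources p)

  sources⊆verts : ∀ {u v} (p : Walk G u v) → sources p ⊆ verts p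
  sources⊆verts (step _ _ p) (here refl)  = here refl
  sources⊆verts (step _ _ p) (there z∈ps) = there (sources⊆verts p z∈ps)

  Unique-sources : ∀ {u v} (p : Walk G u v) → Unique (verts p) → Unique (sources p) × All (_≢ v) (sources p)
  Unique-sources []           _            = [] , []
  Unique-sources (step _ _ p) (u∉p ∷ p!) with Unique-sources p p!
  ... | ps! , ps≢v =
    All.tabulate (λ z∈ps → All.lookup u∉p (sources⊆verts p z∈ps)) ∷ ps! ,
    All.lookup u∉p (end∈verts p) ∷ ps≢v

  interior : ∀ {u v} → Walk G u v → List (Fin n)
  interior []           = []
  interior (step _ _ p) = sources p

  hops≡1+length-interior : ∀ {u v} (p : Walk G u v) → 1 ≤ hops p → hops p ≡ suc (length (interior p))
  hops≡1+length-interior (step _ _ p) _ = cong suc (sym (length-sources p))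

  Unique-interior : ∀ {u v} (p : Walk G u v) → Unique (verts p) → Unique (interior p) × All (λ z → Internal z p) (interior p)
  Unique-interior []           _            = [] , []
  Unique-interior {v = v} (step k e p) (u∉p ∷ p!) with Unique-sources p p!
  ... | ps! , ps≢v = ps! , All.tabulate internal
    where
      internal : ∀ {z} → z ∈ sources p → Internal z (step k e p)
      internal z∈ps = there z∈p , (λ z≡u → All.lookup u∉p z∈p (sym z≡u)) , All.lookup ps≢v z∈ps
        where z∈p = sources⊆verts p z∈ps

  Edge : Fin n → Set
  Edge u = Σ (Fin n) λ w → Σ (Fin M) λ k → G u w ≡ just k

  EdgeOf : ∀ {u} → Fin n → Fin M → Edge u → Set
  EdgeOf w k (w′ , k′ , _) = w′ ≡ w × k′ ≡ k

  edgeTo : ∀ u w (x : Maybe (Fin M)) → G u w ≡ x → List (Edge u)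
  edgeTo u w nothing  _ = []
  edgeTo u w (just k) e = (w , k , e) ∷ []

  edgesTo : ∀ u → List (Fin n) → List (Edge u)
  edgesTo u []       = []
  edgesTo u (w ∷ ws) = edgeTo u w (G u w) refl ++ edgesTo u ws

  edge∈edgesTo : ∀ {u w k} ws → w ∈ ws → G u w ≡ just k → Any (EdgeOf w k) (edgesTo u ws)
  edge∈edgesTo {u} {w} {k} (_ ∷ _)  (here refl)  e = Any.++⁺ˡ (edge∈edgeTo (G u w) refl e)
    where
      edge∈edgeTo : ∀ x (e′ : G u w ≡ x) → x ≡ just k → Any (EdgeOf w k) (edgeTo u w x e′)
      edge∈edgeTo _ _ refl = here (refl , refl)
  edge∈edgesTo {u} (w′ ∷ ws) (there w∈ws) e = Any.++⁺ʳ (edgeTo u w′ (G u w′) refl) (edge∈edgesTo ws w∈ws e)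

  emptyWalks : ∀ u v → List (Walk G u v)
  emptyWalks u v with u Fin.≟ v
  ... | yes refl = [] ∷ []
  ... | no  _    = []

  SameShape : ∀ {u v} → Walk G u v → Walk G u v → Set
  SameShape q q′ = weight q′ ≡ weight q × hops q′ ≡ hops q

  emptyWalks-complete : ∀ {u} → Any (SameShape {u} []) (emptyWalks u u)
  emptyWalks-complete {u} with u Fin.≟ u
  ... | yes refl = here (refl , refl)
  ... | no  u≢u  = ⊥-elim (u≢u refl)

  walksWithin : ℕ → ∀ u v → List (Walk G u v)
  extensions : ℕ → ∀ {u} v → Edge u → List (Walk G u v)
  walksWithin zero    u v = emptyWalks u v
  walksWithin (suc K) u v = emptyWalks u v ++ concatMap (extensions K v) (edgesTo u (allFin n))
  extensions K v (w , k , e) = map (step k e) (walksWithin K w v)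

  walksWithin-complete : ∀ K {u v} (q : Walk G u v) → hops q ≤ K → Any (SameShape q) (walksWithin K u v)
  walksWithin-complete zero    []                   _          = emptyWalks-complete
  walksWithin-complete (suc K) []                   _          = Any.++⁺ˡ emptyWalks-complete
  walksWithin-complete (suc K) {u} {v} (step {w = w} k e q) (s≤s hq≤K) =
    Any.++⁺ʳ (emptyWalks u v) (Any.concatMap⁺ (extensions K v) (Any.map extend (edge∈edgesTo (allFin n) (∈-allFin w) e)))
    where
      extend : ∀ {ed} → EdgeOf w k ed → Any (SameShape (step k e q)) (extensions K v ed)
      extend (refl , refl) =
        Any.map⁺ (Any.map (λ (w≡ , h≡) → cong (suc (toℕ k) +_) w≡ , cong suc h≡) (walksWithin-complete K q hq≤K))

  Canonical : ∀ {u v} → Walk G u v → Set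
  Canonical {u} {v} ρ = 2 ≤ hops ρ × hops ρ ≤ n × All (λ q → weight ρ ≤ weight q) (walksWithin n u v)

  canonical? : ∀ {u v} (ρ : Walk G u v) → Dec (Canonical ρ)
  canonical? {u} {v} ρ = (2 ≤? hops ρ) ×-dec (hops ρ ≤? n) ×-dec All.all? (λ q → weight ρ ≤? weight q) (walksWithin n u v)

  canonical : ∀ u v → Maybe (Σ (Walk G u v) Canonical)
  canonical u v with Any.any? canonical? (walksWithin n u v)
  ... | yes ∃ρ = just (Any.satisfied ∃ρ)
  ... | no  _  = nothing

  Canonical⇒ShortestWithin : ∀ {u v} {ρ : Walk G u v} → Canonical ρ → ShortestWithin n ρ
  Canonical⇒ShortestWithin {ρ = ρ} (_ , _ , ρ≤walks) q hq≤n with All.lookupAny ρ≤walks (walksWithin-complete n q hq≤n)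
  ... | ρ≤q′ , wq′≡wq , _ = subst (weight ρ ≤_) wq′≡wq ρ≤q′

  IsShortest⇒hops<n : ∀ {u v} {p : Walk G u v} → IsShortest p → hops p < n
  IsShortest⇒hops<n {p = p} p-shortest = Unique⇒hops<n p (ShortestWithin⇒Unique (hops p) p ≤-refl (λ q _ → p-shortest q))

  canonical-shortest : ∀ {u v} (p : Walk G u v) → IsShortest p → 2 ≤ hops p →
                       Σ (Σ (Walk G u v) Canonical) λ ρ → canonical u v ≡ just ρ × IsShortest (proj₁ ρ)
  canonical-shortest {u} {v} p p-shortest 2≤hp with Any.any? canonical? (walksWithin n u v)
  ... | yes ∃ρ = ρc , refl , λ q → ≤-trans (Canonical⇒ShortestWithin (proj₂ ρc) p hp≤n) (p-shortest q)
    where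
      ρc = Any.satisfied ∃ρ
      hp≤n = <⇒≤ (IsShortest⇒hops<n p-shortest)
  ... | no  ∄ρ = ⊥-elim (∄ρ (Any.map p-canonical (walksWithin-complete n p hp≤n)))
    where
      hp≤n = <⇒≤ (IsShortest⇒hops<n p-shortest)
      p-canonical : ∀ {q} → SameShape p q → Canonical q
      p-canonical (wq≡wp , hq≡hp) =
        subst (2 ≤_) (sym hq≡hp) 2≤hp ,
        subst (_≤ n) (sym hq≡hp) hp≤n ,
        All.tabulate (λ {q′} _ → subst (_≤ weight q′) (sym wq≡wp) (p-shortest q′))

-- Bijections that miss a pair

module MissedPairs (c : ℕ) {n M : ℕ} (G : Graph n M) where

  open Paths G
  open Arrangements n

  D = 2 + c
  C = 16 * D
  bound = C * M * n * ⌊log₂ n ⌋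

  Misses : ∀ {u v} → Maybe (Σ (Walk G u v) Canonical) → (Fin n → Fin n) → Set
  Misses nothing        π = ⊥
  Misses (just (ρ , _)) π = All (λ z → bound < suc (toℕ (π z)) * weight ρ) (interior ρ)

  misses? : ∀ {u v} (x : Maybe (Σ (Walk G u v) Canonical)) π → Dec (Misses x π)
  misses? nothing        π = no λ ()
  misses? (just (ρ , _)) π = All.all? (λ z → bound <? suc (toℕ (π z)) * weight ρ) (interior ρ)

  MissesAt : Fin n → Fin n → (Fin n → Fin n) → Set
  MissesAt u v = Misses (canonical u v)

  Good-unless-missing : ∀ π → (∀ u v → ¬ MissesAt u v π) → Good G C π
  Good-unless-missing π ¬misses u v (p , p-shortest , 2≤hp) with canonical-shortest p p-shortest 2≤hp
  ... | (ρ , ρ-can) , ≡just , ρ-shortest = ρ , ρ-shortest , early-internal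
    where
      ρ! = ShortestWithin⇒Unique n ρ (proj₁ (proj₂ ρ-can)) (Canonical⇒ShortestWithin ρ-can)
      ¬late : ¬ All (λ z → bound < suc (toℕ (π z)) * weight ρ) (interior ρ)
      ¬late = subst (λ x → ¬ Misses x π) ≡just (¬misses u v)
      early-internal : ∃ λ z → Internal z ρ × suc (toℕ (π z)) * weight ρ ≤ bound
      early-internal
        with All.lookupAny (proj₂ (Unique-interior ρ ρ!))
                           (All.¬All⇒Any¬ (λ z → bound <? suc (toℕ (π z)) * weight ρ) (interior ρ) ¬late)
      ... | z-internal , z-early = _ , z-internal , ≮⇒≥ z-early

  ¬Good⇒misses : ∀ π → ¬ Good G C π → Any (λ u → Any (λ v → MissesAt u v π) (allFin n)) (allFin n)
  ¬Good⇒misses π ¬good with Any.any? (λ u → Any.any? (λ v → misses? (canonical u v) π) (allFin n)) (allFin n)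
  ... | yes misses = misses
  ... | no  none   = ⊥-elim (¬good (Good-unless-missing π (λ u v m → none (somewhere u (somewhere v m)))))
    where
      somewhere : ∀ {P : Fin n → Set} x → P x → Any P (allFin n)
      somewhere {P} x px = Any.map (λ x≡y → subst P x≡y px) (∈-allFin x)

  length-missing : ∀ {u v} (x : Maybe (Σ (Walk G u v) Canonical)) πs → AllPairs Distinct πs →
                   All (Injective _≡_ _≡_) πs → All (Misses x) πs → length πs * n ^ D ≤ n !
  length-missing nothing        []      _ _ _        = z≤n
  length-missing nothing        (_ ∷ _) _ _ (() ∷ _)
  length-missing (just (ρ , ρ-can@(2≤hρ , hρ≤n , _))) πs πs-distinct πs-inj πs-miss = begin
      length πs * n ^ D
        ≤⟨ *-monoˡ-≤ (n ^ D) (length≤injections-above t S! πs πs-distinct πs-inj (All.map above-t πs-miss)) ⟩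
      falling (n ∸ t) 0 k * (n ∸ k) ! * n ^ D  ≡⟨ xy∙z≈xz∙y (falling (n ∸ t) 0 k) ((n ∸ k) !) (n ^ D) ⟩
      falling (n ∸ t) 0 k * n ^ D * (n ∸ k) !  ≤⟨ *-monoˡ-≤ ((n ∸ k) !) decay ⟩
      falling n 0 k * (n ∸ k) !                ≡⟨ !≡falling*! k≤n ⟨
      n !                                      ∎
    where
      open ≤-Reasoning
      ρ! = ShortestWithin⇒Unique n ρ hρ≤n (Canonical⇒ShortestWithin ρ-can)
      S = interior ρ
      k = length S
      S! = proj₁ (Unique-interior ρ ρ!)
      hρ≡1+k = hops≡1+length-interior ρ (≤-trans (s≤s z≤n) 2≤hρ)
      1≤k : 1 ≤ k
      1≤k = s≤s⁻¹ (subst (2 ≤_) hρ≡1+k 2≤hρ)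
      2+k≤n : 2 + k ≤ n
      2+k≤n = subst (λ h → suc h ≤ n) hρ≡1+k (Unique⇒hops<n ρ ρ!)
      k≤n : k ≤ n
      k≤n = ≤-trans (m≤n+m k 2) 2+k≤n
      2≤n : 2 ≤ n
      2≤n = ≤-trans (m≤m+n 2 k) 2+k≤n
      instance
        L≢0 : NonZero ⌊log₂ n ⌋
        L≢0 = >-nonZero (⌊log₂⌋-mono-≤ {2} {n} 2≤n)
      open Threshold c ⌊log₂ n ⌋ {M = M} (n≤2^[2*⌊log₂n⌋] 2≤n) 1≤k k≤n
             (subst (λ h → weight ρ ≤ M * h) hρ≡1+k (weight≤M*hops ρ)) using (threshold)
      t = proj₁ threshold
      t*w≤bound = proj₁ (proj₂ threshold)
      decay = proj₂ (proj₂ threshold)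
      above-t : ∀ {π} → Misses (just (ρ , ρ-can)) π → All (λ z → t ≤ toℕ (π z)) S
      above-t = All.map (λ late → ≮⇒≥ (λ πz<t → <⇒≱ late (≤-trans (*-monoˡ-≤ (weight ρ) πz<t) t*w≤bound)))

  bad-fraction : BadFractionAtMost c n M G C
  bad-fraction []            _      _           _                 = z≤n
  bad-fraction πs@(π₀ ∷ _) πs-inj πs-distinct ¬good@(¬good₀ ∷ _) =
    m*n^[2+c]≤n*[n*o]⇒m*n^c≤o (length πs) c {{n≢0}}
      (subst (λ N → length πs * n ^ D ≤ N * (N * n !)) (length-tabulate {n = n} (λ x → x))
        (union-bound (λ u π → Any (λ v → MissesAt u v π) (allFin n))
                     (λ u π → Any.any? (λ v → misses? (canonical u v) π) (allFin n))
                     (n ^ D) (length (allFin n) * n !) missing-from (allFin n) πs πs-distinct πs-inj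
                     (All.map (¬Good⇒misses _) ¬good)))
    where
      n≢0 : NonZero n
      n≢0 = Fin.nonZeroIndex (proj₁ (Any.satisfied (¬Good⇒misses π₀ ¬good₀)))
      missing-from : ∀ u πs → AllPairs Distinct πs → All (Injective _≡_ _≡_) πs →
                     All (λ π → Any (λ v → MissesAt u v π) (allFin n)) πs → length πs * n ^ D ≤ length (allFin n) * n !
      missing-from u = union-bound (MissesAt u) (λ v → misses? (canonical u v)) (n ^ D) (n !)
                                   (λ v → length-missing (canonical u v)) (allFin n)

claim21 : (c : ℕ) → ∃ λ (C : ℕ) → (n M : ℕ) (G : Graph n M) → BadFractionAtMost c n M G C
claim21 c = 16 * (2 + c) , λ n M G → MissedPairs.bad-fraction c G
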